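{- Let $k\ge 2$ and let $N$ be a finite set with $|N|=n$ and $\log_2 n\ge k$. Let $p$ be the unique positive integer with $pk\le\lfloor\log_2 n\rfloor\le (p+1)k-1$, let $\mathcal{V}=\{v\in\mathbb{Z}_+^k\mid \sum_{i=1}^k v_i=pk-k+1\}$, and choose distinct elements $e_v\in N$ for $v\in\mathcal{V}$. For $i\in[k]$ let $N_i=\{e_v\mid v\in\mathcal{V},\ v_i\ge1\}$, $Z_i=\{e_v\mid v\in\mathcal{V},\ v_i=0\}$, and define $f_i:2^N\to\mathbb{R}$ by $f_i(S)=\max\{0,\max\{2p+1-v_i\mid e_v\in S\cap N_i\}\}$ if $S\cap N_i\ne\emptyset$ and $S\cap Z_i=\emptyset$; $f_i(S)=0$ if $S\cap N_i=\emptyset$ and $S\cap Z_i=\emptyset$; $f_i(S)=2pk+1$ if $S\cap Z_i\ne\emptyset$. Then $f_i$ is monotone and submodular for each $i\in[k]$.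
   Context: $[k]=\{1,\ldots,k\}$, $\mathbb{Z}_+$ denotes the nonnegative integers. A set function $f$ is submodular if $f(S)+f(T)\ge f(S\cup T)+f(S\cap T)$ for all $S,T\subseteq N$, and monotone if $S\subseteq T$ implies $f(S)\le f(T)$. (Note $|\mathcal{V}|=\binom{pk}{k-1}\le n$, so the choice of distinct $e_v$ is possible.) -}

module Defs where

open import Data.Nat using (ℕ; zero; suc; _+_; _*_; _∸_; _≤_; _⊔_; _≟_; _≤?_)
open import Data.Bool using (Bool; true; false; if_then_else_; _∧_; _∨_)
open import Data.Fin using (Fin)
open import Data.Fin.Subset using (Subset; _∪_; _∩_; _⊆_)
open import Data.List using (List; []; _∷_; map; concatMap; foldr; filter; upTo)
open import Data.Bool.ListAction using (any)
open import Relation.Binary.PropositionalEquality using (_≡_)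
import Data.Bool as B
open import Data.Vec using (Vec; []; _∷_; lookup; sum)
open import Relation.Nullary.Decidable using (⌊_⌋)

comps : (k s : ℕ) → List (Vec ℕ k)
comps zero zero = [] ∷ []
comps zero (suc s) = []
comps (suc k) s = concatMap (λ a → map (a ∷_) (comps k (s ∸ a))) (upTo (suc s))

inV : (k p : ℕ) → Vec ℕ k → Set
inV k p v = sum v ≡ p * k ∸ k + 1

𝒱 : (k p : ℕ) → List (Vec ℕ k)
𝒱 k p = comps k (p * k ∸ k + 1)

mem : {n : ℕ} → Subset n → Fin n → Bool
mem S x = lookup S x

-- f_i(S) for the family (e_v)_{v ∈ 𝒱}, e : ℤ₊^k → N (only its values on 𝒱 matter).
--   if S ∩ Z_i ≠ ∅ : 2pk+1
--   otherwise      : max{0, max{2p+1 − v_i | e_v ∈ S ∩ N_i}}   (0 if S ∩ N_i = ∅)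
-- (truncated subtraction ∸ on ℕ together with the max with 0 is exactly max{0, ·})
f : {n : ℕ} (k p : ℕ) (e : Vec ℕ k → Fin n) (i : Fin k) → Subset n → ℕ
f k p e i S =
  if any (λ v → ⌊ lookup v i ≟ 0 ⌋ ∧ mem S (e v)) (𝒱 k p)
  then 2 * p * k + 1
  else foldr _⊔_ 0
         (map (λ v → 2 * p + 1 ∸ lookup v i)
              (filter (λ v → 1 ≤? lookup v i) (filter (λ v → mem S (e v) B.≟ true) (𝒱 k p))))

Monotone : {n : ℕ} → (Subset n → ℕ) → Set
Monotone {n} g = (S T : Subset n) → S ⊆ T → g S ≤ g T

Submodular : {n : ℕ} → (Subset n → ℕ) → Set
Submodular {n} g = (S T : Subset n) → g (S ∪ T) + g (S ∩ T) ≤ g S + g T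

-- f_i(S) is the largest weight of an index v with e_v ∈ S, where v weighs 2pk+1 if v_i = 0
-- and 2p+1 − v_i otherwise: the zero-level indices dominate every other weight, so the
-- case distinction in f_i collapses to a single maximum. A maximum of weights over the
-- members of S is monotone and maxitive (g(S ∪ T) ≤ g S ⊔ g T), and every monotone
-- maxitive function is submodular.
module Submission where

open import Defs
open import Data.Nat using (ℕ; zero; suc; _+_; _*_; _∸_; _≤_; _⊔_; _≟_; _≤?_; z≤n; s≤s)
open import Data.Nat.Properties
open import Data.Nat.Logarithm using (⌊log₂_⌋)
open import Algebra.Properties.CommutativeSemigroup ⊔-commutativeSemigroup using (interchange)
open import Data.Bool using (Bool; true; false; if_then_else_; _∧_; _∨_)
import Data.Bool as B
open import Data.Bool.ListAction using (any)
open import Data.Fin using (Fin)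
open import Data.Fin.Subset using (Subset; _∪_; _∩_; _⊆_)
open import Data.Fin.Subset.Properties using (p∩q⊆p; p∩q⊆q)
open import Data.List using (List; []; _∷_; map; foldr; filter)
open import Data.List.Properties using (filter-accept)
open import Data.Vec using (Vec; lookup)
open import Data.Vec.Properties using (lookup-zipWith; []=⇒lookup; lookup⇒[]=)
open import Data.Product using (_×_; _,_)
open import Data.Sum using (inj₁; inj₂)
open import Relation.Nullary.Decidable using (⌊_⌋)
open import Relation.Binary.PropositionalEquality using (_≡_; refl; sym; cong; subst)
open ≤-Reasoning

Maxitive : {n : ℕ} → (Subset n → ℕ) → Set
Maxitive {n} g = (S T : Subset n) → g (S ∪ T) ≤ g S ⊔ g T

monotone∧maxitive⇒submodular : {n : ℕ} {g : Subset n → ℕ} →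
  Monotone g → Maxitive g → Submodular g
monotone∧maxitive⇒submodular {g = g} mono max S T with ≤-total (g S) (g T)
... | inj₁ gS≤gT = begin
  g (S ∪ T) + g (S ∩ T) ≤⟨ +-mono-≤ (max S T) (mono _ _ (p∩q⊆p S T)) ⟩
  g S ⊔ g T + g S       ≡⟨ cong (_+ g S) (m≤n⇒m⊔n≡n gS≤gT) ⟩
  g T + g S             ≡⟨ +-comm (g T) (g S) ⟩
  g S + g T             ∎
... | inj₂ gT≤gS = begin
  g (S ∪ T) + g (S ∩ T) ≤⟨ +-mono-≤ (max S T) (mono _ _ (p∩q⊆q S T)) ⟩
  g S ⊔ g T + g T       ≡⟨ cong (_+ g T) (m≥n⇒m⊔n≡m gT≤gS) ⟩
  g S + g T             ∎

module WeightedMax {n : ℕ} {A : Set} (elem : A → Fin n) (w : A → ℕ) where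

  weightIn : Subset n → A → ℕ
  weightIn S a = if mem S (elem a) then w a else 0

  maxWeight : List A → Subset n → ℕ
  maxWeight L S = foldr _⊔_ 0 (map (weightIn S) L)

  weightIn-mono : ∀ {S T} → S ⊆ T → ∀ a → weightIn S a ≤ weightIn T a
  weightIn-mono {S} {T} S⊆T a with mem S (elem a) in a∈S
  ... | false = z≤n
  ... | true rewrite []=⇒lookup (S⊆T (lookup⇒[]= (elem a) S a∈S)) = ≤-refl

  maxWeight-monotone : ∀ L → Monotone (maxWeight L)
  maxWeight-monotone []      S T S⊆T = z≤n
  maxWeight-monotone (a ∷ L) S T S⊆T =
    ⊔-mono-≤ (weightIn-mono S⊆T a) (maxWeight-monotone L S T S⊆T)

  weightIn-∪ : ∀ S T a → weightIn (S ∪ T) a ≤ weightIn S a ⊔ weightIn T a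
  weightIn-∪ S T a rewrite lookup-zipWith _∨_ (elem a) S T
    with mem S (elem a) | mem T (elem a)
  ... | true  | _     = m≤m⊔n _ _
  ... | false | true  = m≤n⊔m _ _
  ... | false | false = z≤n

  maxWeight-maxitive : ∀ L → Maxitive (maxWeight L)
  maxWeight-maxitive []      S T = z≤n
  maxWeight-maxitive (a ∷ L) S T = begin
    weightIn (S ∪ T) a ⊔ maxWeight L (S ∪ T)
      ≤⟨ ⊔-mono-≤ (weightIn-∪ S T a) (maxWeight-maxitive L S T) ⟩
    (weightIn S a ⊔ weightIn T a) ⊔ (maxWeight L S ⊔ maxWeight L T)
      ≡⟨ interchange (weightIn S a) (weightIn T a) (maxWeight L S) (maxWeight L T) ⟩
    (weightIn S a ⊔ maxWeight L S) ⊔ (weightIn T a ⊔ maxWeight L T) ∎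

  maxWeight-submodular : ∀ L → Submodular (maxWeight L)
  maxWeight-submodular L =
    monotone∧maxitive⇒submodular (maxWeight-monotone L) (maxWeight-maxitive L)

  maxWeight-≤ : ∀ {C} → (∀ a → w a ≤ C) → ∀ L S → maxWeight L S ≤ C
  maxWeight-≤ w≤C []      S = z≤n
  maxWeight-≤ {C} w≤C (a ∷ L) S = ⊔-lub (weightIn-≤ (mem S (elem a))) (maxWeight-≤ w≤C L S)
    where
    weightIn-≤ : ∀ b → (if b then w a else 0) ≤ C
    weightIn-≤ true  = w≤C a
    weightIn-≤ false = z≤n

⊔-if-top : ∀ {x C} y → x ≤ C → ∀ b →
  x ⊔ (if b then C else y) ≡ (if b then C else x ⊔ y)
⊔-if-top y x≤C true  = m≤n⇒m⊔n≡n x≤C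
⊔-if-top y x≤C false = refl

module _ {n : ℕ} (k p : ℕ) (e : Vec ℕ k → Fin n) (i : Fin k) where

  top : ℕ
  top = 2 * p * k + 1

  levelWeight : ℕ → ℕ
  levelWeight zero    = top
  levelWeight (suc m) = 2 * p + 1 ∸ suc m

  open WeightedMax e (λ v → levelWeight (lookup v i))

  levelWeight-≤ : 1 ≤ k → ∀ m → levelWeight m ≤ top
  levelWeight-≤ k≥1 zero    = ≤-refl
  levelWeight-≤ k≥1 (suc m) = begin
    2 * p + 1 ∸ suc m ≤⟨ m∸n≤m (2 * p + 1) (suc m) ⟩
    2 * p + 1         ≡⟨ cong (_+ 1) (sym (*-identityʳ (2 * p))) ⟩
    2 * p * 1 + 1     ≤⟨ +-monoˡ-≤ 1 (*-monoʳ-≤ (2 * p) k≥1) ⟩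
    top               ∎

  hitsZeroLevel : List (Vec ℕ k) → Subset n → Bool
  hitsZeroLevel L S = any (λ v → ⌊ lookup v i ≟ 0 ⌋ ∧ mem S (e v)) L

  positiveLevelMax : List (Vec ℕ k) → Subset n → ℕ
  positiveLevelMax L S = foldr _⊔_ 0
    (map (λ v → 2 * p + 1 ∸ lookup v i)
         (filter (λ v → 1 ≤? lookup v i) (filter (λ v → mem S (e v) B.≟ true) L)))

  cases≡maxWeight : 1 ≤ k → ∀ L S →
    (if hitsZeroLevel L S then top else positiveLevelMax L S) ≡ maxWeight L S
  cases≡maxWeight k≥1 []      S = refl
  cases≡maxWeight k≥1 (v ∷ L) S with mem S (e v) | lookup v i in vᵢ≡
  ... | false | zero  = cases≡maxWeight k≥1 L S
  ... | false | suc m = cases≡maxWeight k≥1 L S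
  ... | true  | zero  =
    sym (m≥n⇒m⊔n≡m (maxWeight-≤ (λ w → levelWeight-≤ k≥1 (lookup w i)) L S))
  ... | true  | suc m
    rewrite filter-accept (λ w → 1 ≤? lookup w i) {v} {filter (λ w → mem S (e w) B.≟ true) L}
              (subst (1 ≤_) (sym vᵢ≡) (s≤s z≤n))
          | vᵢ≡ =
    begin-equality
      (if hitsZeroLevel L S then top else levelWeight (suc m) ⊔ positiveLevelMax L S)
        ≡⟨ sym (⊔-if-top _ (levelWeight-≤ k≥1 (suc m)) (hitsZeroLevel L S)) ⟩
      levelWeight (suc m) ⊔ (if hitsZeroLevel L S then top else positiveLevelMax L S)
        ≡⟨ cong (levelWeight (suc m) ⊔_) (cases≡maxWeight k≥1 L S) ⟩
      levelWeight (suc m) ⊔ maxWeight L S ∎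

  f≡maxWeight : 1 ≤ k → ∀ S → f k p e i S ≡ maxWeight (𝒱 k p) S
  f≡maxWeight k≥1 = cases≡maxWeight k≥1 (𝒱 k p)

lemma5 : (k n : ℕ) → 2 ≤ k → k ≤ ⌊log₂ n ⌋ →
    (p : ℕ) → 1 ≤ p → p * k ≤ ⌊log₂ n ⌋ → ⌊log₂ n ⌋ ≤ (p + 1) * k ∸ 1 →
    (e : Vec ℕ k → Fin n) →
    (∀ v w → inV k p v → inV k p w → e v ≡ e w → v ≡ w) →
    (i : Fin k) → Monotone (f k p e i) × Submodular (f k p e i)
lemma5 k n k≥2 _ p _ _ _ e _ i = monotone , submodular
  where
  open WeightedMax e (λ v → levelWeight k p e i (lookup v i))

  f≡ : ∀ S → f k p e i S ≡ maxWeight (𝒱 k p) S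
  f≡ = f≡maxWeight k p e i (≤-trans (s≤s z≤n) k≥2)

  monotone : Monotone (f k p e i)
  monotone S T S⊆T rewrite f≡ S | f≡ T = maxWeight-monotone (𝒱 k p) S T S⊆T

  submodular : Submodular (f k p e i)
  submodular S T rewrite f≡ S | f≡ T | f≡ (S ∪ T) | f≡ (S ∩ T) =
    maxWeight-submodular (𝒱 k p) S T
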